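{- Let $q$ be a prime power and let $G=(\mathbb F_q^5,\cdot)$ be the group with operation $X\cdot Y=(x_1+y_1,\,x_2+y_2,\,x_3+y_3,\,x_4+y_4+2x_1y_2,\,x_5+y_5+2x_1y_3)$ for $X=(x_1,\dots,x_5)$, $Y=(y_1,\dots,y_5)$. Let $S=\{(x,xa,xa^2,x^2a,x^2a^2): a,x\in\mathbb F_q,\ x\neq 0\}$. Then $S=S^{ -1}$, and the point graph $\Gamma^{(2)}(q)$ is equal to the Cayley graph $\mathrm{Cay}(G,S)$.
   Context: $\Gamma(q)$ is the bipartite graph with parts points $(p)=(p_1,\dots,p_5)\in\mathbb F_q^5$ and lines $[\ell]=[\ell_1,\dots,\ell_5]\in\mathbb F_q^5$, where $(p)$ is adjacent to $[\ell]$ iff $p_2+\ell_2=p_1\ell_1$, $p_3+\ell_3=p_1\ell_1^2$, $p_4+\ell_4=p_1^2\ell_1$, $p_5+\ell_5=p_1^2\ell_1^2$. The point graph $\Gamma^{(2)}(q)$ has vertex set the set of points, two distinct points being adjacent iff they have a common neighbor (line) in $\Gamma(q)$. For a group $G$ and $S\subseteq G$ with $S=S^{ -1}$, the Cayley graph $\mathrm{Cay}(G,S)$ has vertex set $G$, with $x$ adjacent to $y$ iff $y=xs$ for some $s\in S$. -}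

module Defs where

open import Level using (Level; _⊔_; suc)
open import Algebra.Bundles using (CommutativeRing)
open import Data.Product using (Σ; ∃; _×_; _,_)
open import Data.List using (List)
open import Data.List.Relation.Unary.Any using (Any)
open import Relation.Nullary using (¬_)

record IsField {c ℓ : Level} (R : CommutativeRing c ℓ) : Set (c ⊔ ℓ) where
  open CommutativeRing R
  field
    0≉1     : ¬ (0# ≈ 1#)
    inverse : ∀ x → ¬ (x ≈ 0#) → ∃ λ y → (x * y) ≈ 1#

IsFinite : {c ℓ : Level} (R : CommutativeRing c ℓ) → Set (c ⊔ ℓ)
IsFinite R = ∃ λ (xs : List Carrier) → ∀ x → Any (x ≈_) xs
  where open CommutativeRing R

-- A finite field F_q (q = number of elements, necessarily a prime power).
record FiniteField (c ℓ : Level) : Set (Level.suc (c ⊔ ℓ)) where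
  field
    cring   : CommutativeRing c ℓ
    isField : IsField cring
    finite  : IsFinite cring
  open CommutativeRing cring public

module Construction {c ℓ : Level} (F : FiniteField c ℓ) where
  open FiniteField F

  -- elements of F^5 (used for points, lines, and elements of G)
  record V5 : Set c where
    constructor ⟨_,_,_,_,_⟩
    field
      c1 c2 c3 c4 c5 : Carrier
  open V5 public

  _≈5_ : V5 → V5 → Set ℓ
  X ≈5 Y = (c1 X ≈ c1 Y) × (c2 X ≈ c2 Y) × (c3 X ≈ c3 Y)
         × (c4 X ≈ c4 Y) × (c5 X ≈ c5 Y)

  two : Carrier
  two = 1# + 1#

  Incident : V5 → V5 → Set ℓ
  Incident p l =
      (c2 p + c2 l ≈ c1 p * c1 l)
    × (c3 p + c3 l ≈ c1 p * (c1 l * c1 l))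
    × (c4 p + c4 l ≈ (c1 p * c1 p) * c1 l)
    × (c5 p + c5 l ≈ (c1 p * c1 p) * (c1 l * c1 l))

  PointAdj : V5 → V5 → Set (c ⊔ ℓ)
  PointAdj p p' = ¬ (p ≈5 p') × ∃ λ l → Incident p l × Incident p' l

  _·_ : V5 → V5 → V5
  X · Y = ⟨ c1 X + c1 Y , c2 X + c2 Y , c3 X + c3 Y
          , c4 X + c4 Y + two * (c1 X * c2 Y)
          , c5 X + c5 Y + two * (c1 X * c3 Y) ⟩

  e : V5
  e = ⟨ 0# , 0# , 0# , 0# , 0# ⟩

  InS : V5 → Set (c ⊔ ℓ)
  InS s = ∃ λ a → ∃ λ x → ¬ (x ≈ 0#) ×
          (s ≈5 ⟨ x , x * a , x * (a * a) , (x * x) * a , (x * x) * (a * a) ⟩)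

  InSinv : V5 → Set (c ⊔ ℓ)
  InSinv y = ∃ λ s → InS s × ((y · s) ≈5 e)

  CayAdj : V5 → V5 → Set (c ⊔ ℓ)
  CayAdj x y = ∃ λ s → InS s × (y ≈5 (x · s))

{-# OPTIONS --safe #-}
-- Write S(a, x) = (x, xa, xa², x²a, x²a²), so S = {S(a, x) : x ≠ 0}. In G one has
-- S(a, x) · S(a, y) = S(a, x + y) (the last two coordinates are (x + y)² a and
-- (x + y)² a²), so x ↦ S(a, x) is a homomorphism from (F_q, +), whence
-- S(a, x)⁻¹ = S(a, -x) ∈ S. For the graphs: a point is determined by its first
-- coordinate together with any line through it, and right multiplication by
-- S(a, x) moves a point along every line of slope a through it, changing the
-- first coordinate by x. Hence two distinct points on a common line [ℓ] differ
-- by a right factor S(ℓ₁, x) with x ≠ 0, and conversely p and p · S(a, x) both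
-- lie on the line of slope a through p.
module Submission where

open import Defs
open import Level using (Level)
open import Algebra.Bundles using (CommutativeRing)
open import Data.Product using (_×_; _,_; proj₁)
open import Function.Bundles using (_⇔_; mk⇔)
open import Relation.Binary.Bundles using (Setoid)
open import Relation.Nullary using (¬_)
import Algebra.Properties.Ring as RingProperties
import Algebra.Solver.Ring.NaturalCoefficients.Default as NatSolver
import Relation.Binary.Reasoning.Setoid as SetoidReasoning

module RingIdentities {c ℓ : Level} (R : CommutativeRing c ℓ) where
  open CommutativeRing R
  open RingProperties ring using (+-cancelʳ; xyx⁻¹≈y)
  open NatSolver commutativeSemiring using (solve; _:=_; _:+_; _:*_)
  open SetoidReasoning setoid

  double : ∀ y → (1# + 1#) * y ≈ y + y
  double y = trans (distribʳ y 1# 1#) (+-cong (*-identityˡ y) (*-identityˡ y))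

  square-expansion : ∀ u v b →
    (u * u) * b + (v * v) * b + (1# + 1#) * (u * (v * b)) ≈ ((u + v) * (u + v)) * b
  square-expansion u v b = begin
    (u * u) * b + (v * v) * b + (1# + 1#) * (u * (v * b))
      ≈⟨ +-congˡ (double _) ⟩
    (u * u) * b + (v * v) * b + (u * (v * b) + u * (v * b))
      ≈⟨ solve 3 (λ u v b → (u :* u) :* b :+ (v :* v) :* b :+ (u :* (v :* b) :+ u :* (v :* b))
                            := ((u :+ v) :* (u :+ v)) :* b) refl u v b ⟩
    ((u + v) * (u + v)) * b ∎

  translate-linear : ∀ {u w P} x b → u + w ≈ P * b → (u + x * b) + w ≈ (P + x) * b
  translate-linear {u} {w} {P} x b h = begin
    (u + x * b) + w  ≈⟨ solve 3 (λ u w d → (u :+ d) :+ w := (u :+ w) :+ d) refl u w (x * b) ⟩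
    (u + w) + x * b  ≈⟨ +-congʳ h ⟩
    P * b + x * b    ≈⟨ distribʳ b P x ⟨
    (P + x) * b      ∎

  translate-quadratic : ∀ {u w P} x b → u + w ≈ (P * P) * b →
    (u + (x * x) * b + (1# + 1#) * (P * (x * b))) + w ≈ ((P + x) * (P + x)) * b
  translate-quadratic {u} {w} {P} x b h = begin
    (u + (x * x) * b + t) + w  ≈⟨ solve 4 (λ u w d d′ → (u :+ d :+ d′) :+ w := (u :+ w) :+ d :+ d′)
                                          refl u w ((x * x) * b) t ⟩
    (u + w) + (x * x) * b + t  ≈⟨ +-congʳ (+-congʳ h) ⟩
    (P * P) * b + (x * x) * b + t  ≈⟨ square-expansion P x b ⟩
    ((P + x) * (P + x)) * b    ∎
    where t = (1# + 1#) * (P * (x * b))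

  x+[y-x]≈y : ∀ x y → x + (y - x) ≈ y
  x+[y-x]≈y x y = trans (sym (+-assoc x y (- x))) (xyx⁻¹≈y x y)

  cancel-common : ∀ {u u′ w t t′} → u + w ≈ t → u′ + w ≈ t′ → t ≈ t′ → u ≈ u′
  cancel-common {u} {u′} {w} h h′ t≈t′ = +-cancelʳ w u u′ (trans h (trans t≈t′ (sym h′)))

module GroupAndGraph {c ℓ : Level} (F : FiniteField c ℓ) where
  open FiniteField F
  open Construction F
  open RingIdentities cring
  open RingProperties ring
    using (+-identityʳ-unique; -‿injective; -0#≈0#; x∙y⁻¹≈ε⇒x≈y)

  ≈5-refl : ∀ {X} → X ≈5 X
  ≈5-refl = refl , refl , refl , refl , refl

  ≈5-sym : ∀ {X Y} → X ≈5 Y → Y ≈5 X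
  ≈5-sym (h1 , h2 , h3 , h4 , h5) = sym h1 , sym h2 , sym h3 , sym h4 , sym h5

  ≈5-trans : ∀ {X Y Z} → X ≈5 Y → Y ≈5 Z → X ≈5 Z
  ≈5-trans (h1 , h2 , h3 , h4 , h5) (k1 , k2 , k3 , k4 , k5) =
    trans h1 k1 , trans h2 k2 , trans h3 k3 , trans h4 k4 , trans h5 k5

  V5-setoid : Setoid c ℓ
  V5-setoid = record
    { Carrier = V5
    ; _≈_ = _≈5_
    ; isEquivalence = record { refl = ≈5-refl ; sym = ≈5-sym ; trans = ≈5-trans }
    }

  ·-cong : ∀ {X X′ Y Y′} → X ≈5 X′ → Y ≈5 Y′ → (X · Y) ≈5 (X′ · Y′)
  ·-cong (h1 , h2 , h3 , h4 , h5) (k1 , k2 , k3 , k4 , k5) =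
    +-cong h1 k1 , +-cong h2 k2 , +-cong h3 k3 ,
    +-cong (+-cong h4 k4) (*-congˡ (*-cong h1 k2)) ,
    +-cong (+-cong h5 k5) (*-congˡ (*-cong h1 k3))

  ·-cancelʳ : ∀ {X Y Z} → (X · Z) ≈5 (Y · Z) → X ≈5 Y
  ·-cancelʳ {X} {Y} {Z} (h1 , h2 , h3 , h4 , h5) =
    x1≈y1 , cancel-common h2 refl refl , cancel-common h3 refl refl ,
    cancel-common (cancel-common h4 (+-congˡ (*-congˡ (*-congʳ x1≈y1))) refl) refl refl ,
    cancel-common (cancel-common h5 (+-congˡ (*-congˡ (*-congʳ x1≈y1))) refl) refl refl
    where
    x1≈y1 : c1 X ≈ c1 Y
    x1≈y1 = cancel-common h1 refl refl

  S-elem : Carrier → Carrier → V5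
  S-elem a x = ⟨ x , x * a , x * (a * a) , (x * x) * a , (x * x) * (a * a) ⟩

  S-elem-cong : ∀ a {x y} → x ≈ y → S-elem a x ≈5 S-elem a y
  S-elem-cong a x≈y =
    x≈y , *-congʳ x≈y , *-congʳ x≈y , *-congʳ (*-cong x≈y x≈y) , *-congʳ (*-cong x≈y x≈y)

  S-elem-+ : ∀ a x y → (S-elem a x · S-elem a y) ≈5 S-elem a (x + y)
  S-elem-+ a x y =
    refl , sym (distribʳ a x y) , sym (distribʳ (a * a) x y) ,
    square-expansion x y a , square-expansion x y (a * a)

  S-elem-0 : ∀ a → S-elem a 0# ≈5 e
  S-elem-0 a = refl , zeroˡ a , zeroˡ (a * a) ,
    trans (*-congʳ (zeroˡ 0#)) (zeroˡ a) , trans (*-congʳ (zeroˡ 0#)) (zeroˡ (a * a))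

  InS-S-elem : ∀ a {x} → ¬ (x ≈ 0#) → InS (S-elem a x)
  InS-S-elem a {x} x≉0 = a , x , x≉0 , ≈5-refl

  -‿nonzero : ∀ {x} → ¬ (x ≈ 0#) → ¬ (- x ≈ 0#)
  -‿nonzero x≉0 -x≈0 = x≉0 (-‿injective (trans -x≈0 (sym -0#≈0#)))

  S-elem-inverseʳ : ∀ a x → (S-elem a x · S-elem a (- x)) ≈5 e
  S-elem-inverseʳ a x = begin
    S-elem a x · S-elem a (- x)  ≈⟨ S-elem-+ a x (- x) ⟩
    S-elem a (x + - x)           ≈⟨ S-elem-cong a (-‿inverseʳ x) ⟩
    S-elem a 0#                  ≈⟨ S-elem-0 a ⟩
    e                            ∎
    where open SetoidReasoning V5-setoid

  S-elem-inverseˡ : ∀ a x → (S-elem a (- x) · S-elem a x) ≈5 e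
  S-elem-inverseˡ a x = begin
    S-elem a (- x) · S-elem a x  ≈⟨ S-elem-+ a (- x) x ⟩
    S-elem a (- x + x)           ≈⟨ S-elem-cong a (-‿inverseˡ x) ⟩
    S-elem a 0#                  ≈⟨ S-elem-0 a ⟩
    e                            ∎
    where open SetoidReasoning V5-setoid

  InS⇒InSinv : ∀ y → InS y → InSinv y
  InS⇒InSinv y (a , x , x≉0 , y≈s) =
    S-elem a (- x) , InS-S-elem a (-‿nonzero x≉0) ,
    ≈5-trans (·-cong y≈s ≈5-refl) (S-elem-inverseʳ a x)

  InSinv⇒InS : ∀ y → InSinv y → InS y
  InSinv⇒InS y (s , (a , x , x≉0 , s≈) , y·s≈e) =
    a , - x , -‿nonzero x≉0 , ·-cancelʳ {Z = S-elem a x} (begin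
      y · S-elem a x            ≈⟨ ·-cong ≈5-refl s≈ ⟨
      y · s                     ≈⟨ y·s≈e ⟩
      e                         ≈⟨ S-elem-inverseˡ a x ⟨
      S-elem a (- x) · S-elem a x ∎)
    where open SetoidReasoning V5-setoid

  Incident-resp : ∀ {p p′ l} → p ≈5 p′ → Incident p l → Incident p′ l
  Incident-resp (h1 , h2 , h3 , h4 , h5) (i2 , i3 , i4 , i5) =
    trans (+-congʳ (sym h2)) (trans i2 (*-congʳ h1)) ,
    trans (+-congʳ (sym h3)) (trans i3 (*-congʳ h1)) ,
    trans (+-congʳ (sym h4)) (trans i4 (*-congʳ (*-cong h1 h1))) ,
    trans (+-congʳ (sym h5)) (trans i5 (*-congʳ (*-cong h1 h1)))

  Incident-unique : ∀ {p p′ l} → Incident p l → Incident p′ l → c1 p ≈ c1 p′ → p ≈5 p′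
  Incident-unique (i2 , i3 , i4 , i5) (j2 , j3 , j4 , j5) h1 =
    h1 , cancel-common i2 j2 (*-congʳ h1) , cancel-common i3 j3 (*-congʳ h1) ,
    cancel-common i4 j4 (*-congʳ (*-cong h1 h1)) , cancel-common i5 j5 (*-congʳ (*-cong h1 h1))

  Incident-·S-elem : ∀ {p l} x → Incident p l → Incident (p · S-elem (c1 l) x) l
  Incident-·S-elem {l = l} x (i2 , i3 , i4 , i5) =
    translate-linear x a i2 , translate-linear x (a * a) i3 ,
    translate-quadratic x a i4 , translate-quadratic x (a * a) i5
    where a = c1 l

  lineThrough : V5 → Carrier → V5
  lineThrough p a = ⟨ a , c1 p * a - c2 p , c1 p * (a * a) - c3 p
                    , (c1 p * c1 p) * a - c4 p , (c1 p * c1 p) * (a * a) - c5 p ⟩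

  Incident-lineThrough : ∀ p a → Incident p (lineThrough p a)
  Incident-lineThrough p a = x+[y-x]≈y _ _ , x+[y-x]≈y _ _ , x+[y-x]≈y _ _ , x+[y-x]≈y _ _

  PointAdj⇒CayAdj : ∀ p p′ → PointAdj p p′ → CayAdj p p′
  PointAdj⇒CayAdj p p′ (p≉p′ , l , i , i′) =
    S-elem (c1 l) x , InS-S-elem (c1 l) x≉0 ,
    ≈5-sym (Incident-unique (Incident-·S-elem x i) i′ (x+[y-x]≈y (c1 p) (c1 p′)))
    where
    x = c1 p′ - c1 p
    x≉0 : ¬ (x ≈ 0#)
    x≉0 x≈0 = p≉p′ (Incident-unique i i′ (sym (x∙y⁻¹≈ε⇒x≈y (c1 p′) (c1 p) x≈0)))

  CayAdj⇒PointAdj : ∀ p p′ → CayAdj p p′ → PointAdj p p′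
  CayAdj⇒PointAdj p p′ (s , (a , x , x≉0 , s≈) , p′≈p·s) =
    p≉p′ , lineThrough p a , Incident-lineThrough p a ,
    Incident-resp (≈5-sym p′≈p·S) (Incident-·S-elem x (Incident-lineThrough p a))
    where
    p′≈p·S : p′ ≈5 (p · S-elem a x)
    p′≈p·S = ≈5-trans p′≈p·s (·-cong ≈5-refl s≈)
    p≉p′ : ¬ (p ≈5 p′)
    p≉p′ (p1≈p′1 , _) = x≉0 (+-identityʳ-unique (c1 p) x (sym (trans p1≈p′1 (proj₁ p′≈p·S))))

lemma2p2 : {c ℓ : Level} (F : FiniteField c ℓ) → let open Construction F in
    ((y : V5) → InS y ⇔ InSinv y)
    × ((p p' : V5) → PointAdj p p' ⇔ CayAdj p p')
lemma2p2 F =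
  (λ y → mk⇔ (InS⇒InSinv y) (InSinv⇒InS y)) ,
  (λ p p′ → mk⇔ (PointAdj⇒CayAdj p p′) (CayAdj⇒PointAdj p p′))
  where open GroupAndGraph F
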